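{- Let $G=(X,\Gamma)$ be a finite connected undirected graph that is $m$-distance-regular with respect to a partition $\Gamma=\Gamma_1\sqcup\cdots\sqcup\Gamma_m$ and a monomial order $\le$ on $\mathbb{N}^m$. Let $x,y\in X$ with $d_m(x,y)=a=(a_1,\dots,a_m)$. Then for every $b=(b_1,\dots,b_m)\in\mathbb{N}^m$ with $b_i\le a_i$ for all $i$, there exists $z\in X$ with $d_m(x,z)=b$ and $d_m(y,z)=a-b$.
   Context: A monomial order on $\mathbb{N}^m$ is a total order $\le$ such that $a\le b$ implies $a+c\le b+c$ for all $c$, and which is a well-ordering. $e_i$ is the $i$-th unit vector. The classes $\Gamma_i$ are nonempty; a walk is a finite sequence of edges $(\gamma_1,\dots,\gamma_L)$, $\gamma_j=(y_j,y_{j+1})$, joining $y_1$ and $y_{L+1}$ (the empty walk joins a vertex to itself); its $m$-length $\ell_m(\xi)\in\mathbb{N}^m$ has $i$-th coordinate the number of its edges in $\Gamma_i$. The $m$-distance $d_m(x,y)$ is the $\le$-minimum of the $m$-lengths of walks between $x$ and $y$; $\mathcal{D}$ is the set of all $m$-distances. $G$ is $m$-distance-regular w.r.t. the partition and $\le$ if $e_1,\dots,e_m\in\mathcal{D}$ and for all $a,b,c\in\mathcal{D}$ the number of $z$ with $d_m(x,z)=a$, $d_m(z,y)=b$ is the same for all $x,y$ with $d_m(x,y)=c$. -}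

module Defs where

open import Data.Nat using (ℕ; zero; suc; _+_; _∸_; _≤_)
open import Data.Fin using (Fin; _≟_)
open import Data.Vec using (Vec; zipWith; replicate; tabulate; lookup)
open import Data.Maybe using (Maybe; just; nothing)
open import Data.Bool using (if_then_else_)
open import Data.Product using (Σ; ∃; ∃-syntax; _×_; _,_)
open import Data.List using (List; length)
open import Data.List.Membership.Propositional using (_∈_)
open import Data.List.Relation.Unary.Unique.Propositional using (Unique)
open import Relation.Nullary using (¬_)
open import Relation.Nullary.Decidable using (⌊_⌋)
open import Relation.Binary.PropositionalEquality using (_≡_)
open import Relation.Binary.Structures using (IsTotalOrder)
open import Relation.Binary.Core using (Rel)
open import Induction.WellFounded using (WellFounded)
open import Function.Bundles using (_⇔_)
open import Level using (0ℓ)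

_⊕_ : ∀ {m} → Vec ℕ m → Vec ℕ m → Vec ℕ m
_⊕_ = zipWith _+_

_⊖_ : ∀ {m} → Vec ℕ m → Vec ℕ m → Vec ℕ m
_⊖_ = zipWith _∸_

e : ∀ {m} → Fin m → Vec ℕ m
e i = tabulate (λ j → if ⌊ i ≟ j ⌋ then 1 else 0)

_≤ᵥ_ : ∀ {m} → Vec ℕ m → Vec ℕ m → Set
_≤ᵥ_ {m} b a = (i : Fin m) → lookup b i ≤ lookup a i

record MonomialOrder (m : ℕ) : Set₁ where
  field
    _≼_ : Rel (Vec ℕ m) 0ℓ
    isTotalOrder : IsTotalOrder _≡_ _≼_
    compat : ∀ a b c → a ≼ b → (a ⊕ c) ≼ (b ⊕ c)
    wellFounded : WellFounded (λ a b → a ≼ b × ¬ (a ≡ b))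

-- Finite simple undirected graph on vertex set Fin n whose edge set is
-- partitioned into m classes: lab x y ≡ just i  iff  {x,y} is an edge in Γ_i,
-- lab x y ≡ nothing iff {x,y} is not an edge.
record PartitionedGraph (n m : ℕ) : Set where
  field
    lab : Fin n → Fin n → Maybe (Fin m)
    lab-sym : ∀ x y → lab x y ≡ lab y x
    lab-irrefl : ∀ x → lab x x ≡ nothing
    classes-nonempty : ∀ (i : Fin m) → ∃[ x ] ∃[ y ] (lab x y ≡ just i)

module _ {n m : ℕ} (G : PartitionedGraph n m) where
  open PartitionedGraph G

  data Walk : Fin n → Fin n → Set where
    [] : ∀ {x} → Walk x x
    step : ∀ {x y z} (i : Fin m) → lab x y ≡ just i → Walk y z → Walk x z

  mlength : ∀ {x y} → Walk x y → Vec ℕ m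
  mlength [] = replicate m 0
  mlength (step i _ w) = e i ⊕ mlength w

  Connected : Set
  Connected = ∀ x y → Walk x y

module _ {n m : ℕ} (G : PartitionedGraph n m) (O : MonomialOrder m) where
  open MonomialOrder O

  IsMDist : Fin n → Fin n → Vec ℕ m → Set
  IsMDist x y a =
    (Σ (Walk G x y) λ w → mlength G w ≡ a) × (∀ (w : Walk G x y) → a ≼ mlength G w)

  InD : Vec ℕ m → Set
  InD a = ∃[ x ] ∃[ y ] IsMDist x y a

  CountIs : Fin n → Fin n → Vec ℕ m → Vec ℕ m → ℕ → Set
  CountIs x y a b p =
    ∃[ zs ] (Unique zs × length zs ≡ p ×
             (∀ z → (z ∈ zs) ⇔ (IsMDist x z a × IsMDist z y b)))

  MDistanceRegular : Set
  MDistanceRegular =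
    (∀ (i : Fin m) → InD (e i)) ×
    (∀ a b c → InD a → InD b → InD c →
      ∃[ p ] (∀ x y → IsMDist x y c → CountIs x y a b p))

-- If the i-th coordinate of a = d(x,y) is positive, some geodesic from x to y starts
-- with an edge of class i. Follow any geodesic: when its first edge x x′ has class j ≠ i, a
-- geodesic from x′ starting with an i-edge x′ u exists by induction, and then x, u are at distance
-- e_j + e_i. Distance-regularity makes the number of z with d(x,z) = e_j, d(z,u) = e_i equal to the
-- number with d(x,z) = e_i, d(z,u) = e_j (count the former from u); since x′ is of the first kind,
-- some z is of the second, and x z u … y is a geodesic starting with an i-edge. Writing b as a sum
-- of unit vectors and peeling them off one at a time yields a vertex z on a geodesic from x to y
-- with d(x,z) = b; the remaining part of that geodesic has m-length a − b.
module Submission where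

open import Defs
open import Data.Nat using (ℕ; zero; suc; _+_; _≤_; _<_; z≤n; s≤s)
open import Data.Nat.Properties using (+-assoc; +-comm; +-cancelˡ-≡; m+[n∸m]≡n)
open import Data.Fin using (Fin; _≟_) renaming (zero to fzero; suc to fsuc)
open import Data.Vec using (Vec; []; _∷_; head; tail; lookup; replicate)
open import Data.Vec.Properties using (lookup-zipWith; lookup-replicate; lookup∘tabulate; tabulate∘lookup; tabulate-cong)
open import Data.Vec.Relation.Binary.Pointwise.Inductive using (Pointwise-≡⇒≡; zipWith-assoc; zipWith-comm; zipWith-identityˡ)
open import Data.List using (List; map) renaming ([] to []ₗ; _∷_ to _∷ₗ_)
open import Data.List.Relation.Unary.Any using (here)
open import Data.Product using (∃-syntax; _×_; _,_; proj₁; proj₂)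
open import Data.Sum using (inj₁; inj₂)
open import Data.Maybe using (just)
open import Data.Bool using (if_then_else_)
open import Function using (_∘_)
open import Function.Bundles using (Equivalence)
open import Relation.Nullary using (does; yes; no)
open import Relation.Nullary.Decidable using (isYes≗does; ⌊⌋-map′; dec-true; dec-false)
open import Relation.Binary.PropositionalEquality
open import Relation.Binary.Structures using (IsTotalOrder)

⊕-assoc : ∀ {m} (u v w : Vec ℕ m) → (u ⊕ v) ⊕ w ≡ u ⊕ (v ⊕ w)
⊕-assoc u v w = Pointwise-≡⇒≡ (zipWith-assoc +-assoc u v w)

⊕-comm : ∀ {m} (u v : Vec ℕ m) → u ⊕ v ≡ v ⊕ u
⊕-comm u v = Pointwise-≡⇒≡ (zipWith-comm +-comm u v)

⊕-identityˡ : ∀ {m} (u : Vec ℕ m) → replicate m 0 ⊕ u ≡ u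
⊕-identityˡ u = Pointwise-≡⇒≡ (zipWith-identityˡ (λ _ → refl) u)

⊕-identityʳ : ∀ {m} (u : Vec ℕ m) → u ⊕ replicate m 0 ≡ u
⊕-identityʳ u = trans (⊕-comm u _) (⊕-identityˡ u)

⊕-swap : ∀ {m} (u v w : Vec ℕ m) → u ⊕ (v ⊕ w) ≡ v ⊕ (u ⊕ w)
⊕-swap u v w = trans (sym (⊕-assoc u v w)) (trans (cong (_⊕ w) (⊕-comm u v)) (⊕-assoc v u w))

⊕-cancelˡ : ∀ {m} (u v w : Vec ℕ m) → u ⊕ v ≡ u ⊕ w → v ≡ w
⊕-cancelˡ []      []      []      _  = refl
⊕-cancelˡ (x ∷ u) (y ∷ v) (z ∷ w) eq =
  cong₂ _∷_ (+-cancelˡ-≡ x y z (cong head eq)) (⊕-cancelˡ u v w (cong tail eq))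

⊕-cancelʳ : ∀ {m} (u v w : Vec ℕ m) → u ⊕ w ≡ v ⊕ w → u ≡ v
⊕-cancelʳ u v w eq = ⊕-cancelˡ w u v (trans (⊕-comm w u) (trans eq (⊕-comm v w)))

b⊕[a⊖b]≡a : ∀ {m} {a b : Vec ℕ m} → b ≤ᵥ a → b ⊕ (a ⊖ b) ≡ a
b⊕[a⊖b]≡a {a = []}    {[]}    _   = refl
b⊕[a⊖b]≡a {a = _ ∷ _} {_ ∷ _} b≤a = cong₂ _∷_ (m+[n∸m]≡n (b≤a fzero)) (b⊕[a⊖b]≡a (b≤a ∘ fsuc))

e-zero : ∀ {m} → e {suc m} fzero ≡ 1 ∷ replicate m 0
e-zero = cong (1 ∷_) (trans (tabulate-cong (λ j → sym (lookup-replicate j 0))) (tabulate∘lookup _))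

e-suc : ∀ {m} (i : Fin m) → e (fsuc i) ≡ 0 ∷ e i
e-suc i = cong (0 ∷_) (tabulate-cong (λ j → cong (if_then 1 else 0) (⌊⌋-map′ _ _ (i ≟ j))))

lookup-e : ∀ {m} (i j : Fin m) → lookup (e i) j ≡ (if does (i ≟ j) then 1 else 0)
lookup-e i j = trans (lookup∘tabulate _ j) (cong (if_then 1 else 0) (isYes≗does (i ≟ j)))

lookup-e-diag : ∀ {m} (i : Fin m) → lookup (e i) i ≡ 1
lookup-e-diag i = trans (lookup-e i i) (cong (if_then 1 else 0) (dec-true (i ≟ i) refl))

lookup-e-≢ : ∀ {m} {i j : Fin m} → i ≢ j → lookup (e i) j ≡ 0
lookup-e-≢ {i = i} {j} i≢j = trans (lookup-e i j) (cong (if_then 1 else 0) (dec-false (i ≟ j) i≢j))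

lookup-e⊕-positive : ∀ {m} (i : Fin m) (v : Vec ℕ m) → 1 ≤ lookup (e i ⊕ v) i
lookup-e⊕-positive i v =
  subst (1 ≤_) (sym (trans (lookup-zipWith _ i (e i) v) (cong (_+ lookup v i) (lookup-e-diag i)))) (s≤s z≤n)

lookup-e⊕-≢ : ∀ {m} {i j : Fin m} {v : Vec ℕ m} → j ≢ i → lookup (e j ⊕ v) i ≡ lookup v i
lookup-e⊕-≢ {i = i} {j} {v} j≢i = trans (lookup-zipWith _ i (e j) v) (cong (_+ lookup v i) (lookup-e-≢ j≢i))

unitSum : ∀ {m} → List (Fin m) → Vec ℕ m
unitSum []ₗ       = replicate _ 0
unitSum (i ∷ₗ is) = e i ⊕ unitSum is

unitSum-map-suc : ∀ {m} (is : List (Fin m)) → unitSum (map fsuc is) ≡ 0 ∷ unitSum is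
unitSum-map-suc []ₗ       = refl
unitSum-map-suc (i ∷ₗ is) = cong₂ _⊕_ (e-suc i) (unitSum-map-suc is)

unitSum-surjective : ∀ {m} (b : Vec ℕ m) → ∃[ is ] (unitSum is ≡ b)
unitSum-surjective []      = []ₗ , refl
unitSum-surjective (k ∷ b) = cons k (unitSum-surjective b)
  where
  cons : ∀ k → ∃[ is ] (unitSum is ≡ b) → ∃[ is ] (unitSum is ≡ k ∷ b)
  cons zero    (is , eq) = map fsuc is , trans (unitSum-map-suc is) (cong (0 ∷_) eq)
  cons (suc k) r with cons k r
  ... | is , eq = fzero ∷ₗ is , trans (cong₂ _⊕_ e-zero eq) (cong (suc k ∷_) (⊕-identityˡ b))

module Walks {n m : ℕ} (G : PartitionedGraph n m) where
  open PartitionedGraph G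

  infixr 5 _++ʷ_

  _++ʷ_ : ∀ {x y z} → Walk G x y → Walk G y z → Walk G x z
  []         ++ʷ q = q
  step i h p ++ʷ q = step i h (p ++ʷ q)

  mlength-++ʷ : ∀ {x y z} (p : Walk G x y) (q : Walk G y z) →
                mlength G (p ++ʷ q) ≡ mlength G p ⊕ mlength G q
  mlength-++ʷ []           q = sym (⊕-identityˡ _)
  mlength-++ʷ (step i h p) q = trans (cong (e i ⊕_) (mlength-++ʷ p q)) (sym (⊕-assoc (e i) _ _))

  reverseʷ : ∀ {x y} → Walk G x y → Walk G y x
  reverseʷ []                   = []
  reverseʷ (step {x} {y} i h w) = reverseʷ w ++ʷ step i (trans (lab-sym y x) h) []

  mlength-reverseʷ : ∀ {x y} (w : Walk G x y) → mlength G (reverseʷ w) ≡ mlength G w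
  mlength-reverseʷ []           = refl
  mlength-reverseʷ (step i h w) =
    trans (mlength-++ʷ (reverseʷ w) _)
          (trans (cong₂ _⊕_ (mlength-reverseʷ w) (⊕-identityʳ (e i))) (⊕-comm _ (e i)))

  Reach : Fin n → Fin n → Vec ℕ m → Set
  Reach x y a = ∃[ w ] (mlength G {x} {y} w ≡ a)

  _⨾_ : ∀ {x y z a b} → Reach x y a → Reach y z b → Reach x z (a ⊕ b)
  (p , refl) ⨾ (q , refl) = p ++ʷ q , mlength-++ʷ p q

  Reach-sym : ∀ {x y a} → Reach x y a → Reach y x a
  Reach-sym (w , refl) = reverseʷ w , mlength-reverseʷ w

  edge : ∀ {x y i} → lab x y ≡ just i → Reach x y (e i)
  edge {i = i} h = step i h [] , ⊕-identityʳ (e i)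

module _ {n m : ℕ} (G : PartitionedGraph n m) (O : MonomialOrder m) where
  open MonomialOrder O
  open IsTotalOrder isTotalOrder using (total; antisym; reflexive)
  open Walks G

  IsMDist-sym : ∀ {x y a} → IsMDist G O x y a → IsMDist G O y x a
  IsMDist-sym {a = a} (r , minimal) =
    Reach-sym r , λ w → subst (a ≼_) (mlength-reverseʷ w) (minimal (reverseʷ w))

  prefix-minimal : ∀ {x y z b c} → IsMDist G O x y (b ⊕ c) → Reach x z b → Reach z y c →
                   ∀ (w : Walk G x z) → b ≼ mlength G w
  prefix-minimal {b = b} {c} (_ , minimal) _ (q , refl) w with total b (mlength G w)
  ... | inj₁ b≼w = b≼w
  ... | inj₂ w≼b = reflexive (sym (⊕-cancelʳ _ _ c (antisym (compat _ _ c w≼b) bc≼wc)))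
    where
    bc≼wc : (b ⊕ c) ≼ (mlength G w ⊕ c)
    bc≼wc = subst ((b ⊕ c) ≼_) (mlength-++ʷ w q) (minimal (w ++ʷ q))

  geodesic-split : ∀ {x y z b c} → IsMDist G O x y (b ⊕ c) → Reach x z b → Reach z y c →
                   IsMDist G O x z b × IsMDist G O z y c
  geodesic-split {x} {y} {b = b} {c} d p q =
    (p , prefix-minimal d p q) ,
    IsMDist-sym (Reach-sym q , prefix-minimal d′ (Reach-sym q) (Reach-sym p))
    where
    d′ : IsMDist G O y x (c ⊕ b)
    d′ = subst (IsMDist G O _ _) (⊕-comm b c) (IsMDist-sym d)

  CountIs-positive : ∀ {x y z a b p} → CountIs G O x y a b p →
                     IsMDist G O x z a → IsMDist G O z y b → 0 < p
  CountIs-positive ([]ₗ , _ , _ , mem) dxz dzy with Equivalence.from (mem _) (dxz , dzy)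
  ... | ()
  CountIs-positive (_ ∷ₗ _ , _ , refl , _) _ _ = s≤s z≤n

  CountIs-witness : ∀ {x y a b p} → CountIs G O x y a b p → 0 < p →
                    ∃[ z ] (IsMDist G O x z a × IsMDist G O z y b)
  CountIs-witness ([]ₗ , _ , refl , _) ()
  CountIs-witness (z ∷ₗ _ , _ , _ , mem) _ = z , Equivalence.to (mem z) (here refl)

  module _ (regular : MDistanceRegular G O) where

    -- Counting from y instead of x: both {z ∣ d(x,z) = a, d(z,y) = b} and
    -- {z ∣ d(y,z) = a, d(z,x) = b} have the intersection number p^c_ab as size.
    intermediate-swap : ∀ {x y z a b c} → IsMDist G O x y c → IsMDist G O x z a → IsMDist G O z y b →
                        ∃[ z′ ] (IsMDist G O x z′ b × IsMDist G O z′ y a)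
    intermediate-swap {x} {y} {z} dxy dxz dzy
      with proj₂ regular _ _ _ (x , z , dxz) (z , y , dzy) (x , y , dxy)
    ... | _ , count
      with CountIs-witness (count y x (IsMDist-sym dxy)) (CountIs-positive (count x y dxy) dxz dzy)
    ... | z′ , dyz′ , dz′x = z′ , IsMDist-sym dz′x , IsMDist-sym dyz′

    reroute : ∀ {x x′ u y a b c} → IsMDist G O x y (a ⊕ (b ⊕ c)) →
              Reach x x′ a → Reach x′ u b → Reach u y c →
              ∃[ z ] (IsMDist G O x z b × IsMDist G O z y (a ⊕ c))
    reroute {a = a} {b} {c} d p q r
      with geodesic-split (subst (IsMDist G O _ _) (sym (⊕-assoc a b c)) d) (p ⨾ q) r
    ... | dxu , _ with geodesic-split dxu p q
    ... | dxx′ , dx′u with intermediate-swap dxu dxx′ dx′u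
    ... | z , dxz , dzu =
      z , dxz , proj₂ (geodesic-split (subst (IsMDist G O _ _) (⊕-swap a b c) d) (proj₁ dxz) (proj₁ dzu ⨾ r))

    unit-step-along : ∀ {x y} (i : Fin m) (w : Walk G x y) →
                      IsMDist G O x y (mlength G w) → 1 ≤ lookup (mlength G w) i →
                      ∃[ u ] ∃[ c ] (mlength G w ≡ e i ⊕ c × IsMDist G O x u (e i) × IsMDist G O u y c)
    unit-step-along i [] _ pos with subst (1 ≤_) (lookup-replicate i 0) pos
    ... | ()
    unit-step-along i (step j h w) d pos with geodesic-split d (edge h) (w , refl) | j ≟ i
    ... | dxx′ , dx′y | yes refl = _ , _ , refl , dxx′ , dx′y
    ... | _ , dx′y | no j≢i with unit-step-along i w dx′y (subst (1 ≤_) (lookup-e⊕-≢ j≢i) pos)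
    ... | u , c , w≡ , dx′u , duy
      with reroute (subst (IsMDist G O _ _) (cong (e j ⊕_) w≡) d) (edge h) (proj₁ dx′u) (proj₁ duy)
    ... | z , dxz , dzy = z , e j ⊕ c , trans (cong (e j ⊕_) w≡) (⊕-swap (e j) (e i) c) , dxz , dzy

    unit-step : ∀ {x y a} (i : Fin m) → IsMDist G O x y a → 1 ≤ lookup a i →
                ∃[ u ] ∃[ c ] (a ≡ e i ⊕ c × IsMDist G O x u (e i) × IsMDist G O u y c)
    unit-step i d@((w , refl) , _) = unit-step-along i w d

    geodesic-interval-units : ∀ {x y} (is : List (Fin m)) (c : Vec ℕ m) →
                              IsMDist G O x y (unitSum is ⊕ c) →
                              ∃[ z ] (IsMDist G O x z (unitSum is) × IsMDist G O z y c)
    geodesic-interval-units []ₗ c d@((w , w≡) , _) =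
      _ , geodesic-split d ([] , refl) (w , trans w≡ (⊕-identityˡ c))
    geodesic-interval-units (i ∷ₗ is) c d
      with unit-step i (subst (IsMDist G O _ _) (⊕-assoc (e i) (unitSum is) c) d)
                       (lookup-e⊕-positive i (unitSum is ⊕ c))
    ... | u , c′ , a≡ , dxu , duy
      with geodesic-interval-units is c (subst (IsMDist G O u _) (⊕-cancelˡ (e i) c′ _ (sym a≡)) duy)
    ... | z , duz , dzy = z , proj₁ (geodesic-split d (proj₁ dxu ⨾ proj₁ duz) (proj₁ dzy)) , dzy

    geodesic-interval : ∀ {x y} (b c : Vec ℕ m) → IsMDist G O x y (b ⊕ c) →
                        ∃[ z ] (IsMDist G O x z b × IsMDist G O z y c)
    geodesic-interval b c d with unitSum-surjective b
    ... | is , refl = geodesic-interval-units is c d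

lemma3p8 : ∀ {n m : ℕ} (G : PartitionedGraph n m) (O : MonomialOrder m) →
    Connected G → MDistanceRegular G O →
    ∀ (x y : Fin n) (a : Vec ℕ m) → IsMDist G O x y a →
    ∀ (b : Vec ℕ m) → b ≤ᵥ a →
    ∃[ z ] (IsMDist G O x z b × IsMDist G O y z (a ⊖ b))
lemma3p8 G O _ regular x y a d b b≤a
  with geodesic-interval G O regular b (a ⊖ b) (subst (IsMDist G O x y) (sym (b⊕[a⊖b]≡a b≤a)) d)
... | z , dxz , dzy = z , dxz , IsMDist-sym G O dzy
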